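{- Fix a schema $\mathcal{S}$ and $k\geq0$. A safe structure $(A,\mathbf{a})$ over $\mathcal{S}$ with $k$ distinguished elements has a finite frontier with respect to the class of all structures over $\mathcal{S}$ with $k$ distinguished elements if and only if it has a finite frontier with respect to the class of all safe structures over $\mathcal{S}$ with $k$ distinguished elements.
   Context: A structure with $k$ distinguished elements is $(A,\mathbf{a})$, $A$ a finite relational structure and $\mathbf{a}$ a $k$-tuple of its elements; homomorphisms preserve facts and map $a_i$ to $b_i$. $(A,\mathbf{a})$ is safe if every distinguished element $a_i$ occurs in at least one fact of $A$. A frontier for $(A,\mathbf{a})$ w.r.t. a class $\mathcal{C}$ is a set $F$ of structures such that every member of $F$ maps homomorphically to $(A,\mathbf{a})$, $(A,\mathbf{a})$ maps to no member of $F$, and every $(C,\mathbf{c})\in\mathcal{C}$ with $(C,\mathbf{c})\to(A,\mathbf{a})$ and $(A,\mathbf{a})\not\to(C,\mathbf{c})$ maps to some member of $F$. -}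

module Defs where

open import Data.Nat using (ℕ)
open import Data.Fin using (Fin)
open import Data.Vec using (Vec; map; lookup)
open import Data.List using (List)
open import Data.Product using (Σ; ∃; _×_; _,_)
open import Data.Unit using (⊤)
open import Relation.Nullary using (¬_)
open import Relation.Binary.PropositionalEquality using (_≡_)
import Data.List.Membership.Propositional as LM
import Data.Vec.Membership.Propositional as VM

record Schema : Set where
  field
    nsym  : ℕ
    arity : Fin nsym → ℕ
open Schema public

Fact : Schema → ℕ → Set
Fact S n = Σ (Fin (nsym S)) (λ R → Vec (Fin n) (arity S R))

record Structure (S : Schema) (k : ℕ) : Set where
  field
    size  : ℕ
    facts : List (Fact S size)
    dist  : Vec (Fin size) k
open Structure public

mapFact : ∀ {S n m} → (Fin n → Fin m) → Fact S n → Fact S m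
mapFact h (R , t) = R , map h t

_⟶_ : ∀ {S k} → Structure S k → Structure S k → Set
A ⟶ B = Σ (Fin (size A) → Fin (size B)) λ h →
          (∀ f → f LM.∈ facts A → mapFact h f LM.∈ facts B)
          × map h (dist A) ≡ dist B

Safe : ∀ {S k} → Structure S k → Set
Safe {S} {k} A = (i : Fin k) →
  ∃ λ (f : Fact S (size A)) → f LM.∈ facts A × lookup (dist A) i VM.∈ Data.Product.proj₂ f

AllStructures : ∀ {S k} → Structure S k → Set
AllStructures _ = ⊤

IsFrontier : ∀ {S k} → Structure S k → (Structure S k → Set) → List (Structure S k) → Set
IsFrontier {S} {k} A C F =
    (∀ B → B LM.∈ F → B ⟶ A)
  × (∀ B → B LM.∈ F → ¬ (A ⟶ B))
  × (∀ (X : Structure S k) → C X → X ⟶ A → ¬ (A ⟶ X) → ∃ λ B → B LM.∈ F × X ⟶ B)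

HasFiniteFrontier : ∀ {S k} → Structure S k → (Structure S k → Set) → Set
HasFiniteFrontier A C = ∃ λ F → IsFrontier A C F

-- (⇒) A frontier w.r.t. a class is a frontier w.r.t. every subclass.
-- (⇐) Extend a frontier F for the safe class by finitely many "detached"
-- copies of A.  For a marking w ∈ Boolᵏ, Detach w is the disjoint union of
-- A (carrying all facts) with a fact-free copy of A's domain; the i-th
-- distinguished element is a_i in the first copy if w_i = false and in the
-- free copy if w_i = true.  Folding the two copies gives Detach w → A; if
-- some w_i = true then A ↛ Detach w, because a_i lies in a fact of the
-- safe A, whereas its required image lies in the fact-free copy.  Every
-- unsafe X with X → A maps to Detach w, where w marks the distinguished
-- elements of X that occur in no fact: send isolated elements to the free
-- copy.  So F together with Detach w for the (finitely many) markings w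
-- with a true entry is a frontier w.r.t. all structures.
module Submission where

open import Defs
open import Data.Nat using (ℕ; zero; suc; _+_)
open import Data.Bool using (Bool; true; false; not)
open import Data.Fin using (Fin; _↑ˡ_; _↑ʳ_; splitAt)
open import Data.Fin.Properties using (splitAt-↑ˡ; splitAt-↑ʳ; all?; ¬∀⟶∃¬) renaming (_≟_ to _≟F_)
open import Data.Vec as V using (Vec; []; _∷_; lookup; zipWith; _[_]≔_)
open import Data.Vec.Properties using (lookup-map; lookup-zipWith; lookup∘update; []≔-lookup; map-∘; map-cong; map-id)
open import Data.List as L using (List; _++_; cartesianProduct; allFin)
open import Data.List.Relation.Unary.Any using (Any; here; there; any?)
open import Data.Product using (∃; _×_; _,_; proj₁; proj₂)
open import Data.Unit using (tt)
open import Data.Sum using (_⊎_; inj₁; inj₂; [_,_])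
open import Function using (id; _∘_)
open import Function.Bundles using (_⇔_; mk⇔)
open import Relation.Nullary using (¬_; Dec; yes; no; does)
open import Relation.Nullary.Decidable using (dec-true; dec-false)
open import Relation.Binary.PropositionalEquality using (_≡_; refl; sym; trans; cong; cong₂; subst; module ≡-Reasoning)
import Data.List.Membership.Propositional as LM
import Data.List.Membership.Propositional.Properties as LMP
import Data.Vec.Membership.Propositional as VM
import Data.Vec.Membership.Propositional.Properties as VMP
import Data.Vec.Relation.Unary.Any as VAny
import Data.Vec.Relation.Unary.Any.Properties as VAnyP

map-cong-∈ : ∀ {A B : Set} {n} {f g : A → B} (xs : Vec A n) →
  (∀ x → x VM.∈ xs → f x ≡ g x) → V.map f xs ≡ V.map g xs
map-cong-∈ [] _ = refl
map-cong-∈ (x ∷ xs) f≡g =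
  cong₂ _∷_ (f≡g x (VAny.here refl)) (map-cong-∈ xs (λ y y∈ → f≡g y (VAny.there y∈)))

∈-map⁻ : ∀ {A B : Set} {n} (f : A → B) (xs : Vec A n) {y} →
  y VM.∈ V.map f xs → ∃ λ x → y ≡ f x
∈-map⁻ f xs y∈ = VAny.satisfied (VAnyP.map⁻ y∈)

map-pair : ∀ {A B C D : Set} {n} (_⊕_ : B → C → D) (f : A → B) (g : A → C) (xs : Vec A n) →
  V.map (λ x → f x ⊕ g x) xs ≡ zipWith _⊕_ (V.map f xs) (V.map g xs)
map-pair _⊕_ f g [] = refl
map-pair _⊕_ f g (x ∷ xs) = cong (_ ∷_) (map-pair _⊕_ f g xs)

↑ˡ≢↑ʳ : ∀ {m n} (i : Fin m) (j : Fin n) → ¬ (i ↑ˡ n ≡ m ↑ʳ j)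
↑ˡ≢↑ʳ {m} {n} i j eq with trans (sym (splitAt-↑ˡ m i n)) (trans (cong (splitAt m) eq) (splitAt-↑ʳ m n j))
... | ()

allBoolVecs : ∀ k → List (Vec Bool k)
allBoolVecs zero = L.[ [] ]
allBoolVecs (suc k) = L.map (true ∷_) (allBoolVecs k) ++ L.map (false ∷_) (allBoolVecs k)

allBoolVecs-complete : ∀ {k} (v : Vec Bool k) → v LM.∈ allBoolVecs k
allBoolVecs-complete [] = here refl
allBoolVecs-complete (true ∷ v) = LMP.∈-++⁺ˡ (LMP.∈-map⁺ (true ∷_) (allBoolVecs-complete v))
allBoolVecs-complete {suc k} (false ∷ v) =
  LMP.∈-++⁺ʳ (L.map (true ∷_) (allBoolVecs k)) (LMP.∈-map⁺ (false ∷_) (allBoolVecs-complete v))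

nonzeroBoolVecs : ∀ k → List (Vec Bool k)
nonzeroBoolVecs k = L.map (λ (i , v) → v [ i ]≔ true) (cartesianProduct (allFin k) (allBoolVecs k))

nonzeroBoolVecs-sound : ∀ {k} {w : Vec Bool k} → w LM.∈ nonzeroBoolVecs k → ∃ λ i → lookup w i ≡ true
nonzeroBoolVecs-sound w∈ with LMP.∈-map⁻ _ w∈
... | (i , v) , _ , refl = i , lookup∘update i v true

nonzeroBoolVecs-complete : ∀ {k} (w : Vec Bool k) i → lookup w i ≡ true → w LM.∈ nonzeroBoolVecs k
nonzeroBoolVecs-complete w i wi = subst (LM._∈ nonzeroBoolVecs _) w[i]≔true≡w
  (LMP.∈-map⁺ _ (LMP.∈-cartesianProduct⁺ (LMP.∈-allFin i) (allBoolVecs-complete w)))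
  where
  w[i]≔true≡w : w [ i ]≔ true ≡ w
  w[i]≔true≡w = trans (cong (w [ i ]≔_) (sym wi)) ([]≔-lookup w i)

module _ {S : Schema} {k : ℕ} where

  frontier-restrict : {C D : Structure S k → Set} (A : Structure S k) (F : List (Structure S k)) →
    (∀ X → C X → D X) → IsFrontier A D F → IsFrontier A C F
  frontier-restrict A F C⊆D (F⟶A , A↛F , cover) = F⟶A , A↛F , λ X CX → cover X (C⊆D X CX)

  frontier-extend : {C D : Structure S k → Set} (A : Structure S k) (F G : List (Structure S k)) →
    IsFrontier A C F →
    (∀ B → B LM.∈ G → B ⟶ A) → (∀ B → B LM.∈ G → ¬ (A ⟶ B)) →
    (∀ X → D X → X ⟶ A → C X ⊎ (∃ λ B → B LM.∈ G × X ⟶ B)) →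
    IsFrontier A D (F ++ G)
  frontier-extend {D = D} A F G (F⟶A , A↛F , coverF) G⟶A A↛G split =
    below , incomparable , cover
    where
    below : ∀ B → B LM.∈ F ++ G → B ⟶ A
    below B B∈ = [ F⟶A B , G⟶A B ] (LMP.∈-++⁻ F B∈)

    incomparable : ∀ B → B LM.∈ F ++ G → ¬ (A ⟶ B)
    incomparable B B∈ = [ A↛F B , A↛G B ] (LMP.∈-++⁻ F B∈)

    cover : ∀ X → D X → X ⟶ A → ¬ (A ⟶ X) → ∃ λ B → B LM.∈ F ++ G × X ⟶ B
    cover X DX X⟶A A↛X with split X DX X⟶A
    ... | inj₁ CX = let (B , B∈ , X⟶B) = coverF X CX X⟶A A↛X in B , LMP.∈-++⁺ˡ B∈ , X⟶B
    ... | inj₂ (B , B∈ , X⟶B) = B , LMP.∈-++⁺ʳ F B∈ , X⟶B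

  Occurs : (X : Structure S k) → Fin (size X) → Set
  Occurs X y = Any (λ f → y VM.∈ proj₂ f) (facts X)

  occurs? : (X : Structure S k) (y : Fin (size X)) → Dec (Occurs X y)
  occurs? X y = any? (λ f → VAny.any? (y ≟F_) (proj₂ f)) (facts X)

  isolated : (X : Structure S k) → Fin (size X) → Bool
  isolated X y = not (does (occurs? X y))

  isolated-occurs : (X : Structure S k) {y : Fin (size X)} → Occurs X y → isolated X y ≡ false
  isolated-occurs X o rewrite dec-true (occurs? X _) o = refl

  safe-or-isolated : (X : Structure S k) → Safe X ⊎ (∃ λ i → isolated X (lookup (dist X) i) ≡ true)
  safe-or-isolated X with all? (λ i → occurs? X (lookup (dist X) i))
  ... | yes allOccur = inj₁ (λ i → LM.find (allOccur i))
  ... | no notAll with ¬∀⟶∃¬ k _ (λ i → occurs? X (lookup (dist X) i)) notAll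
  ... | i , ¬occ = inj₂ (i , cong not (dec-false (occurs? X _) ¬occ))

  module Detachment (A : Structure S k) where
    private
      n : ℕ
      n = size A

    copy : Bool → Fin n → Fin (n + n)
    copy false a = a ↑ˡ n
    copy true a = n ↑ʳ a

    fold : Fin (n + n) → Fin n
    fold = [ id , id ] ∘ splitAt n

    fold-copy : ∀ b a → fold (copy b a) ≡ a
    fold-copy false a rewrite splitAt-↑ˡ n a n = refl
    fold-copy true a rewrite splitAt-↑ʳ n n a = refl

    fold-dist : ∀ {m} (w : Vec Bool m) (as : Vec (Fin n) m) → V.map fold (zipWith copy w as) ≡ as
    fold-dist [] [] = refl
    fold-dist (b ∷ w) (a ∷ as) = cong₂ _∷_ (fold-copy b a) (fold-dist w as)

    Detach : Vec Bool k → Structure S k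
    Detach w = record
      { size  = n + n
      ; facts = L.map (mapFact (copy false)) (facts A)
      ; dist  = zipWith copy w (dist A)
      }

    Detach⟶A : ∀ w → Detach w ⟶ A
    Detach⟶A w = fold , preserves , fold-dist w (dist A)
      where
      preserves : ∀ f → f LM.∈ facts (Detach w) → mapFact fold f LM.∈ facts A
      preserves f f∈ with LMP.∈-map⁻ (mapFact (copy false)) f∈
      ... | (R , t) , t∈ , refl = subst (LM._∈ facts A) (cong (R ,_) (sym fold-left)) t∈
        where
        open ≡-Reasoning
        fold-left : V.map fold (V.map (copy false) t) ≡ t
        fold-left = begin
          V.map fold (V.map (copy false) t) ≡⟨ map-∘ fold (copy false) t ⟨
          V.map (fold ∘ copy false) t       ≡⟨ map-cong (fold-copy false) t ⟩
          V.map id t                        ≡⟨ map-id t ⟩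
          t                                 ∎

    -- If A is safe and w marks position i, then A ↛ Detach w: a homomorphism
    -- must send a_i into the free copy, yet a fact containing a_i forces its
    -- image into the copy carrying the facts.
    A↛Detach : Safe A → ∀ w i → lookup w i ≡ true → ¬ (A ⟶ Detach w)
    A↛Detach safe w i wi (g , preserves , g-dist) =
      ↑ˡ≢↑ʳ b a (trans (sym ga≡b) ga≡a)
      where
      open ≡-Reasoning
      a = lookup (dist A) i
      occurrence = safe i
      ga∈ : g a VM.∈ proj₂ (mapFact g (proj₁ occurrence))
      ga∈ = VMP.∈-map⁺ g (proj₂ (proj₂ occurrence))
      image = LMP.∈-map⁻ (mapFact (copy false)) (preserves _ (proj₁ (proj₂ occurrence)))
      ga∈left : g a VM.∈ V.map (copy false) (proj₂ (proj₁ image))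
      ga∈left = subst (λ f → g a VM.∈ proj₂ f) (proj₂ (proj₂ image)) ga∈
      b = proj₁ (∈-map⁻ (copy false) _ ga∈left)
      ga≡b : g a ≡ b ↑ˡ n
      ga≡b = proj₂ (∈-map⁻ (copy false) _ ga∈left)
      ga≡a : g a ≡ n ↑ʳ a
      ga≡a = begin
        g a                                ≡⟨ lookup-map i g (dist A) ⟨
        lookup (V.map g (dist A)) i        ≡⟨ cong (λ v → lookup v i) g-dist ⟩
        lookup (zipWith copy w (dist A)) i ≡⟨ lookup-zipWith copy i w (dist A) ⟩
        copy (lookup w i) a                ≡⟨ cong (λ c → copy c a) wi ⟩
        n ↑ʳ a                             ∎

    -- A homomorphism h : X → A lifts to X → Detach w, where w marks the
    -- isolated distinguished elements of X: isolated elements go to the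
    -- free copy, all others (in particular all elements of facts) to the
    -- copy carrying the facts.
    isolation : Structure S k → Vec Bool k
    isolation X = V.map (isolated X) (dist X)

    ⟶Detach : ∀ X → X ⟶ A → X ⟶ Detach (isolation X)
    ⟶Detach X (h , h-preserves , h-dist) = lift , preserves , lift-dist
      where
      open ≡-Reasoning
      lift : Fin (size X) → Fin (n + n)
      lift y = copy (isolated X y) (h y)

      preserves : ∀ f → f LM.∈ facts X → mapFact lift f LM.∈ facts (Detach (isolation X))
      preserves (R , t) f∈ =
        subst (LM._∈ _) (cong (R ,_) lift-on-fact) (LMP.∈-map⁺ (mapFact (copy false)) (h-preserves (R , t) f∈))
        where
        lift-on-fact : V.map (copy false) (V.map h t) ≡ V.map lift t
        lift-on-fact = begin
          V.map (copy false) (V.map h t) ≡⟨ map-∘ (copy false) h t ⟨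
          V.map (copy false ∘ h) t       ≡⟨ map-cong-∈ t (λ y y∈ →
                                              cong (λ c → copy c (h y)) (sym (isolated-occurs X (LM.lose f∈ y∈)))) ⟩
          V.map lift t                   ∎

      lift-dist : V.map lift (dist X) ≡ zipWith copy (isolation X) (dist A)
      lift-dist = begin
        V.map lift (dist X)                                   ≡⟨ map-pair copy (isolated X) h (dist X) ⟩
        zipWith copy (isolation X) (V.map h (dist X))         ≡⟨ cong (zipWith copy (isolation X)) h-dist ⟩
        zipWith copy (isolation X) (dist A)                   ∎

    detachments : List (Structure S k)
    detachments = L.map Detach (nonzeroBoolVecs k)

lemma4p4 : (S : Schema) (k : ℕ) (A : Structure S k) → Safe A →
    HasFiniteFrontier A AllStructures ⇔ HasFiniteFrontier A Safe
lemma4p4 S k A safe = mk⇔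
  (λ (F , frontier) → F , frontier-restrict A F (λ _ _ → tt) frontier)
  (λ (F , frontier) → F ++ detachments , frontier-extend A F detachments frontier below incomparable split)
  where
  open Detachment A

  below : ∀ B → B LM.∈ detachments → B ⟶ A
  below B B∈ with LMP.∈-map⁻ Detach B∈
  ... | w , _ , refl = Detach⟶A w

  incomparable : ∀ B → B LM.∈ detachments → ¬ (A ⟶ B)
  incomparable B B∈ with LMP.∈-map⁻ Detach B∈
  ... | w , w∈ , refl = let (i , wi) = nonzeroBoolVecs-sound w∈ in A↛Detach safe w i wi

  split : ∀ X → AllStructures X → X ⟶ A → Safe X ⊎ (∃ λ B → B LM.∈ detachments × X ⟶ B)
  split X _ X⟶A with safe-or-isolated X
  ... | inj₁ safeX = inj₁ safeX
  ... | inj₂ (i , isolated-i) = inj₂ (Detach (isolation X) ,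
          LMP.∈-map⁺ Detach (nonzeroBoolVecs-complete _ i (trans (lookup-map i (isolated X) (dist X)) isolated-i)) ,
          ⟶Detach X X⟶A)
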